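{- Let $n \geq 5$. The Rose Window graph $R_n(1,2)$ is a core graph. Moreover, $R_n(1,2)$ is a nut graph if and only if $n \not\equiv 0 \pmod 3$.
   Context: The Rose Window graph $R_n(a,r)$ has vertex set $\{v_0,\dots,v_{n-1}\} \cup \{u_0,\dots,u_{n-1}\}$ and edge set $\{v_iv_{i+1},\ u_iu_{i+r},\ u_iv_i,\ u_iv_{i+a} : i = 0,\dots,n-1\}$, indices modulo $n$. A core graph is a graph $G$ with $\eta(G) \ge 1$ (nullity of the adjacency matrix) for which there is a vector in $\ker \mathbf{A}(G)$ with no zero entry. A nut graph is a core graph of nullity $1$, i.e. a simple connected graph whose adjacency matrix has one-dimensional kernel spanned by a vector with no zero entry.
   Formalization: The kernel vectors of the adjacency matrix, and with them the nullity η, are taken over the rationals. -}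

module Defs where

open import Data.Nat using (ℕ; zero; suc; NonZero)
open import Data.Nat.DivMod using (_%_)
open import Data.Fin using (Fin; zero; suc; toℕ; splitAt)
open import Data.Bool using (Bool; true; false; _∨_; if_then_else_)
open import Data.Sum using (_⊎_; inj₁; inj₂)
open import Data.Product using (Σ; _×_; ∃; _,_)
open import Data.Rational using (ℚ; 0ℚ; 1ℚ; _+_; _*_)
open import Relation.Nullary using (¬_; does)
open import Relation.Binary.PropositionalEquality using (_≡_; _≢_)
import Data.Nat as ℕ

record Graph (m : ℕ) : Set where
  field
    adj : Fin m → Fin m → Bool
open Graph public

sumFin : ∀ {m} → (Fin m → ℚ) → ℚ
sumFin {zero}  f = 0ℚ
sumFin {suc m} f = f zero + sumFin (λ i → f (suc i))

adjMatrix : ∀ {m} → Graph m → Fin m → Fin m → ℚ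
adjMatrix G x y = if adj G x y then 1ℚ else 0ℚ

InKernel : ∀ {m} → Graph m → (Fin m → ℚ) → Set
InKernel G x = ∀ w → sumFin (λ w' → adjMatrix G w w' * x w') ≡ 0ℚ

NonZeroVec : ∀ {m} → (Fin m → ℚ) → Set
NonZeroVec x = Σ _ λ w → x w ≢ 0ℚ

FullVec : ∀ {m} → (Fin m → ℚ) → Set
FullVec x = ∀ w → x w ≢ 0ℚ

NullityAtLeast1 : ∀ {m} → Graph m → Set
NullityAtLeast1 G = Σ _ λ x → InKernel G x × NonZeroVec x

NullityOne : ∀ {m} → Graph m → Set
NullityOne G = Σ _ λ x → InKernel G x × NonZeroVec x ×
               (∀ y → InKernel G y → Σ ℚ λ c → ∀ w → y w ≡ c * x w)

IsCore : ∀ {m} → Graph m → Set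
IsCore G = NullityAtLeast1 G × Σ _ λ x → InKernel G x × FullVec x

data Reach {m} (G : Graph m) : Fin m → Fin m → Set where
  here : ∀ {x} → Reach G x x
  step : ∀ {x y z} → adj G x y ≡ true → Reach G y z → Reach G x z

Connected : ∀ {m} → Graph m → Set
Connected G = ∀ x y → Reach G x y

IsNut : ∀ {m} → Graph m → Set
IsNut G = Connected G × IsCore G × NullityOne G

eqShift : ∀ {n} ⦃ _ : NonZero n ⦄ → Fin n → Fin n → ℕ → Bool
eqShift {n} j i k = does ((toℕ i ℕ.+ k) % n ℕ.≟ toℕ j)

-- Rose Window graph R_n(a,r): vertices Fin (n + n); the first n are v_0..v_{n-1},
-- the last n are u_0..u_{n-1}.
-- Edges: v_i v_{i+1}, u_i u_{i+r}, u_i v_i, u_i v_{i+a} (indices mod n).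
roseAdj : (n a r : ℕ) → ⦃ _ : NonZero n ⦄ → Fin (n ℕ.+ n) → Fin (n ℕ.+ n) → Bool
roseAdj n a r x y with splitAt n x | splitAt n y
... | inj₁ i | inj₁ j = (eqShift j i 1) ∨ (eqShift i j 1)
... | inj₂ i | inj₂ j = (eqShift j i r) ∨ (eqShift i j r)
... | inj₂ i | inj₁ j = (eqShift j i 0) ∨ (eqShift j i a)
... | inj₁ i | inj₂ j = (eqShift i j 0) ∨ (eqShift i j a)

RoseWindow : (n a r : ℕ) → ⦃ _ : NonZero n ⦄ → Graph (n ℕ.+ n)
RoseWindow n a r = record { adj = roseAdj n a r }

{-# OPTIONS --safe #-}
module Submission where

open import Defs
open import Data.Nat using (ℕ; _≤_; NonZero)
open import Data.Nat.DivMod using (_%_)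
open import Data.Product using (_×_)
open import Function.Bundles using (_⇔_)
open import Relation.Nullary using (¬_)
open import Relation.Binary.PropositionalEquality using (_≡_)

import Data.Rational.Properties as ℚP
open import Algebra.Bundles using (CommutativeRing)
open import Algebra.Properties.CommutativeMonoid.Sum ℚP.+-0-commutativeMonoid
  using (sum; sum-cong-≗; ∑-distrib-+; sum-replicate-zero)
open import Algebra.Properties.Group ℚP.+-0-group
  using (identityˡ-unique; inverseʳ-unique; x∙y⁻¹≈ε⇒x≈y)
open import Algebra.Properties.Semiring.Mult (CommutativeRing.semiring ℚP.+-*-commutativeRing)
  using (×-assoc-*) renaming (_×_ to _·_)
open import Data.Bool using (Bool; true; _∨_; if_then_else_)
open import Data.Empty using (⊥-elim)
open import Data.Fin as Fin using (Fin; zero; suc; toℕ; splitAt; _↑ˡ_; _↑ʳ_)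
open import Data.Fin.Properties
  using (toℕ-injective; toℕ-fromℕ<; fromℕ<-cong; fromℕ<-toℕ; toℕ<n;
         splitAt-↑ˡ; splitAt-↑ʳ; splitAt⁻¹-↑ˡ; splitAt⁻¹-↑ʳ)
open import Data.Nat as ℕ using (zero; suc; _<_; _∸_; z≤n; s≤s; >-nonZero⁻¹)
import Data.Nat.Properties as ℕP
open import Data.Nat.DivMod
  using (_/_; _mod_; m%n<n; m%n%n≡m%n; %-distribˡ-+; [m+n]%n≡m%n; m<n⇒m%n≡m; m≡m%n+[m/n]*n)
open import Data.Nat.Divisibility using (_∣_; divides; m%n≡0⇒n∣m; n∣m⇒m%n≡0)
open import Data.Nat.GCD using (module Bézout)
open import Data.Nat.Coprimality using (Coprime; coprime-Bézout)
open import Data.Nat.Primality using (Irreducible; irreducible?)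
open import Data.Product using (Σ; _,_; proj₁; proj₂)
open import Data.Rational using (ℚ; 0ℚ; 1ℚ; _+_; _*_; -_; _-_; 1/_)
import Data.Rational as ℚ
open import Data.Rational.Solver using (module +-*-Solver)
open import Data.Sum using (inj₁; inj₂; [_,_]′)
open import Function using (_∘_; mk⇔; Equivalence)
open import Relation.Binary.PropositionalEquality
  using (_≢_; ≢-sym; refl; sym; trans; cong; cong₂; subst; subst₂; _≗_; module ≡-Reasoning)
open import Relation.Nullary using (does; yes; no)
open import Relation.Nullary.Decidable using (does-⇔; dec-true; toWitness)

open ≡-Reasoning
open +-*-Solver using (solve; _:=_; _:+_; _:-_; _:*_; :-_; con)

-- Write a vector on R_n(1,2) as two n-periodic sequences, A on the rim vertices v_i and
-- B on the vertices u_i. The kernel equations become a linear recurrence in A and B, which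
-- the sign vector (A = -1, B = 1) satisfies; it has no zero entry, so the graph is a core
-- graph. A combination of four equations shows that A(m+3) - A(m) has period 3. If 3 does
-- not divide n it also has period n, hence (Bézout) period 1; so A is an arithmetic
-- progression along every residue class mod 3, and n-periodicity forces the common
-- difference to vanish. Then A has periods 3 and n, so it is constant, and the equations
-- force B = -A: the kernel is spanned by the sign vector. If 3 divides n, two independent
-- 3-periodic solutions show that the nullity is at least 2. Connectivity comes from the rim
-- cycle and the spokes v_i u_i.

sumFin≡sum : ∀ {m} (f : Fin m → ℚ) → sumFin f ≡ sum f
sumFin≡sum {zero}  f = refl
sumFin≡sum {suc m} f = cong (f zero +_) (sumFin≡sum (f ∘ suc))

sum-↑ : ∀ m {n} (f : Fin (m ℕ.+ n) → ℚ) → sum f ≡ sum (f ∘ (_↑ˡ n)) + sum (f ∘ (m ↑ʳ_))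
sum-↑ zero        f = sym (ℚP.+-identityˡ _)
sum-↑ (suc m) {n} f = begin
  f zero + sum (f ∘ suc)
    ≡⟨ cong (f zero +_) (sum-↑ m (f ∘ suc)) ⟩
  f zero + (sum (f ∘ suc ∘ (_↑ˡ n)) + sum (f ∘ suc ∘ (m ↑ʳ_)))
    ≡⟨ ℚP.+-assoc (f zero) _ _ ⟨
  f zero + sum (f ∘ suc ∘ (_↑ˡ n)) + sum (f ∘ suc ∘ (m ↑ʳ_)) ∎

indicator : Bool → ℚ
indicator b = if b then 1ℚ else 0ℚ

sum-point : ∀ {m} (p : Fin m) (f : Fin m → ℚ) →
  sum (λ j → indicator (does (j Fin.≟ p)) * f j) ≡ f p
sum-point {suc m} zero f = begin
  1ℚ * f zero + sum (λ j → 0ℚ * f (suc j))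
    ≡⟨ cong₂ _+_ (ℚP.*-identityˡ (f zero)) (sum-cong-≗ {m} (ℚP.*-zeroˡ ∘ f ∘ suc)) ⟩
  f zero + sum {m} (λ _ → 0ℚ)
    ≡⟨ cong (f zero +_) (sum-replicate-zero m) ⟩
  f zero + 0ℚ
    ≡⟨ ℚP.+-identityʳ (f zero) ⟩
  f zero ∎
sum-point {suc m} (suc p) f =
  trans (cong₂ _+_ (ℚP.*-zeroˡ (f zero)) (sum-point p (f ∘ suc))) (ℚP.+-identityˡ _)

sum-two-points : ∀ {m} {p q : Fin m} (P : Fin m → Bool) (f : Fin m → ℚ) →
  (∀ j → P j ≡ does (j Fin.≟ p) ∨ does (j Fin.≟ q)) → p ≢ q →
  sum (λ j → indicator (P j) * f j) ≡ f p + f q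
sum-two-points {p = p} {q} P f P≗p∨q p≢q = begin
  sum (λ j → indicator (P j) * f j) ≡⟨ sum-cong-≗ split ⟩
  sum (λ j → at p j + at q j)       ≡⟨ ∑-distrib-+ (at p) (at q) ⟩
  sum (at p) + sum (at q)           ≡⟨ cong₂ _+_ (sum-point p f) (sum-point q f) ⟩
  f p + f q                         ∎
  where
  at : _ → _ → ℚ
  at s j = indicator (does (j Fin.≟ s)) * f j
  split : ∀ j → indicator (P j) * f j ≡ at p j + at q j
  split j rewrite P≗p∨q j with j Fin.≟ p | j Fin.≟ q
  ... | yes j≡p | yes j≡q = ⊥-elim (p≢q (trans (sym j≡p) j≡q))
  ... | yes _   | no _    = sym (trans (cong (1ℚ * f j +_) (ℚP.*-zeroˡ (f j))) (ℚP.+-identityʳ _))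
  ... | no _    | yes _   = sym (trans (cong (_+ 1ℚ * f j) (ℚP.*-zeroˡ (f j))) (ℚP.+-identityˡ _))
  ... | no _    | no _    = sym (trans (cong (_+ 0ℚ * f j) (ℚP.*-zeroˡ (f j))) (ℚP.+-identityˡ _))

-- Arithmetic modulo n

module Modular (n : ℕ) ⦃ _ : NonZero n ⦄ where

  [m%n+k]%n≡[m+k]%n : ∀ m k → (m % n ℕ.+ k) % n ≡ (m ℕ.+ k) % n
  [m%n+k]%n≡[m+k]%n m k = begin
    (m % n ℕ.+ k) % n         ≡⟨ %-distribˡ-+ (m % n) k n ⟩
    (m % n % n ℕ.+ k % n) % n ≡⟨ cong (λ t → (t ℕ.+ k % n) % n) (m%n%n≡m%n m n) ⟩
    (m % n ℕ.+ k % n) % n     ≡⟨ %-distribˡ-+ m k n ⟨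
    (m ℕ.+ k) % n             ∎

  k+[m+[n∸k]]≡n+m : ∀ {k} m → k ≤ n → k ℕ.+ (m ℕ.+ (n ∸ k)) ≡ n ℕ.+ m
  k+[m+[n∸k]]≡n+m {k} m k≤n = begin
    k ℕ.+ (m ℕ.+ (n ∸ k)) ≡⟨ cong (k ℕ.+_) (ℕP.+-comm m (n ∸ k)) ⟩
    k ℕ.+ ((n ∸ k) ℕ.+ m) ≡⟨ ℕP.+-assoc k (n ∸ k) m ⟨
    k ℕ.+ (n ∸ k) ℕ.+ m   ≡⟨ cong (ℕ._+ m) (ℕP.m+[n∸m]≡n k≤n) ⟩
    n ℕ.+ m               ∎

  ≢-∸ : ∀ {k l} → l ≤ n → k ℕ.+ l ≢ n → k ≢ n ∸ l
  ≢-∸ l≤n k+l≢n refl = k+l≢n (ℕP.m∸n+n≡m l≤n)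

  toℕ-mod : ∀ m → toℕ (m mod n) ≡ m % n
  toℕ-mod m = toℕ-fromℕ< (m%n<n m n)

  mod-cong : ∀ {m m′} → m % n ≡ m′ % n → m mod n ≡ m′ mod n
  mod-cong e = fromℕ<-cong _ _ e (m%n<n _ n) (m%n<n _ n)

  toℕ-mod-id : ∀ i → toℕ i mod n ≡ i
  toℕ-mod-id i =
    trans (fromℕ<-cong _ _ (m<n⇒m%n≡m (toℕ<n i)) _ (toℕ<n i)) (fromℕ<-toℕ i (toℕ<n i))

  [n+m]mod≡m-mod : ∀ m → (n ℕ.+ m) mod n ≡ m mod n
  [n+m]mod≡m-mod m = mod-cong (trans (cong (_% n) (ℕP.+-comm n m)) ([m+n]%n≡m%n m n))

  infixl 6 _⊕_

  _⊕_ : Fin n → ℕ → Fin n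
  i ⊕ k = (toℕ i ℕ.+ k) mod n

  mod-⊕ : ∀ m k → m mod n ⊕ k ≡ (k ℕ.+ m) mod n
  mod-⊕ m k = mod-cong (begin
    (toℕ (m mod n) ℕ.+ k) % n ≡⟨ cong (λ t → (t ℕ.+ k) % n) (toℕ-mod m) ⟩
    (m % n ℕ.+ k) % n         ≡⟨ [m%n+k]%n≡[m+k]%n m k ⟩
    (m ℕ.+ k) % n             ≡⟨ cong (_% n) (ℕP.+-comm m k) ⟩
    (k ℕ.+ m) % n             ∎)

  ⊕-assoc : ∀ i k l → i ⊕ k ⊕ l ≡ i ⊕ (k ℕ.+ l)
  ⊕-assoc i k l = begin
    i ⊕ k ⊕ l                   ≡⟨ mod-⊕ (toℕ i ℕ.+ k) l ⟩
    (l ℕ.+ (toℕ i ℕ.+ k)) mod n ≡⟨ cong (_mod n) (ℕP.+-comm l (toℕ i ℕ.+ k)) ⟩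
    (toℕ i ℕ.+ k ℕ.+ l) mod n   ≡⟨ cong (_mod n) (ℕP.+-assoc (toℕ i) k l) ⟩
    i ⊕ (k ℕ.+ l)               ∎

  ⊕-identityʳ : ∀ i → i ⊕ 0 ≡ i
  ⊕-identityʳ i = trans (cong (_mod n) (ℕP.+-identityʳ (toℕ i))) (toℕ-mod-id i)

  ⊕-n : ∀ i → i ⊕ n ≡ i
  ⊕-n i = begin
    (toℕ i ℕ.+ n) mod n ≡⟨ cong (_mod n) (ℕP.+-comm (toℕ i) n) ⟩
    (n ℕ.+ toℕ i) mod n ≡⟨ [n+m]mod≡m-mod (toℕ i) ⟩
    toℕ i mod n         ≡⟨ toℕ-mod-id i ⟩
    i                   ∎

  ⊕-rotate : ∀ {k} m → k ≤ n → (k ℕ.+ m) mod n ⊕ (n ∸ k) ≡ m mod n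
  ⊕-rotate {k} m k≤n = begin
    (k ℕ.+ m) mod n ⊕ (n ∸ k)     ≡⟨ mod-⊕ (k ℕ.+ m) (n ∸ k) ⟩
    ((n ∸ k) ℕ.+ (k ℕ.+ m)) mod n ≡⟨ cong (_mod n) (ℕP.+-comm (n ∸ k) (k ℕ.+ m)) ⟩
    (k ℕ.+ m ℕ.+ (n ∸ k)) mod n   ≡⟨ cong (_mod n) (ℕP.+-assoc k m (n ∸ k)) ⟩
    (k ℕ.+ (m ℕ.+ (n ∸ k))) mod n ≡⟨ cong (_mod n) (k+[m+[n∸k]]≡n+m m k≤n) ⟩
    (n ℕ.+ m) mod n               ≡⟨ [n+m]mod≡m-mod m ⟩
    m mod n                       ∎

  ⊕-inverse : ∀ {i j k} → k ≤ n → j ⊕ k ≡ i → i ⊕ (n ∸ k) ≡ j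
  ⊕-inverse {j = j} {k} k≤n refl = begin
    j ⊕ k ⊕ (n ∸ k)     ≡⟨ ⊕-assoc j k (n ∸ k) ⟩
    j ⊕ (k ℕ.+ (n ∸ k)) ≡⟨ cong (j ⊕_) (ℕP.m+[n∸m]≡n k≤n) ⟩
    j ⊕ n               ≡⟨ ⊕-n j ⟩
    j                   ∎

  ⊕-cancelˡ : ∀ i {c d} → c < n → d < n → i ⊕ c ≡ i ⊕ d → c ≡ d
  ⊕-cancelˡ i c<n d<n e = begin
    _                         ≡⟨ back c<n ⟨
    toℕ (i ⊕ _ ⊕ (n ∸ toℕ i)) ≡⟨ cong (λ x → toℕ (x ⊕ (n ∸ toℕ i))) e ⟩
    toℕ (i ⊕ _ ⊕ (n ∸ toℕ i)) ≡⟨ back d<n ⟩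
    _                         ∎
    where
    back : ∀ {c} → c < n → toℕ (i ⊕ c ⊕ (n ∸ toℕ i)) ≡ c
    back {c} c<n = begin
      toℕ (i ⊕ c ⊕ (n ∸ toℕ i))           ≡⟨ cong toℕ (⊕-assoc i c (n ∸ toℕ i)) ⟩
      toℕ (i ⊕ (c ℕ.+ (n ∸ toℕ i)))       ≡⟨ toℕ-mod _ ⟩
      (toℕ i ℕ.+ (c ℕ.+ (n ∸ toℕ i))) % n ≡⟨ cong (_% n) (k+[m+[n∸k]]≡n+m c (ℕP.<⇒≤ (toℕ<n i))) ⟩
      (n ℕ.+ c) % n                       ≡⟨ cong (_% n) (ℕP.+-comm n c) ⟩
      (c ℕ.+ n) % n                       ≡⟨ [m+n]%n≡m%n c n ⟩
      c % n                               ≡⟨ m<n⇒m%n≡m c<n ⟩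
      c                                   ∎

  ⊕-distinct : ∀ i {c d} → c < n → d < n → c ≢ d → i ⊕ c ≢ i ⊕ d
  ⊕-distinct i c<n d<n c≢d = c≢d ∘ ⊕-cancelˡ i c<n d<n

  ≢-⊕ : ∀ i {c} → c < n → 0 ≢ c → i ≢ i ⊕ c
  ≢-⊕ i c<n 0≢c = ⊕-distinct i (>-nonZero⁻¹ n) c<n 0≢c ∘ trans (⊕-identityʳ i)

  eqShift-⊕ : ∀ j i k → eqShift j i k ≡ does (j Fin.≟ i ⊕ k)
  eqShift-⊕ j i k = does-⇔ (mk⇔ to from) ((toℕ i ℕ.+ k) % n ℕ.≟ toℕ j) (j Fin.≟ i ⊕ k)
    where
    to : (toℕ i ℕ.+ k) % n ≡ toℕ j → j ≡ i ⊕ k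
    to e = toℕ-injective (trans (sym e) (sym (toℕ-mod _)))
    from : j ≡ i ⊕ k → (toℕ i ℕ.+ k) % n ≡ toℕ j
    from refl = sym (toℕ-mod _)

  eqShift-⊖ : ∀ i j k → k ≤ n → eqShift i j k ≡ does (j Fin.≟ i ⊕ (n ∸ k))
  eqShift-⊖ i j k k≤n =
    trans (eqShift-⊕ i j k) (does-⇔ (mk⇔ to from) (i Fin.≟ j ⊕ k) (j Fin.≟ i ⊕ (n ∸ k)))
    where
    to : i ≡ j ⊕ k → j ≡ i ⊕ (n ∸ k)
    to e = sym (⊕-inverse k≤n (sym e))
    from : j ≡ i ⊕ (n ∸ k) → i ≡ j ⊕ k
    from e = sym (subst (λ t → j ⊕ t ≡ i) (ℕP.m∸[m∸n]≡n k≤n) (⊕-inverse (ℕP.m∸n≤m n k) (sym e)))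

-- Rose Window graphs

row : ∀ {m} → Graph m → (Fin m → ℚ) → Fin m → ℚ
row G y w = sumFin (λ w′ → adjMatrix G w w′ * y w′)

reach-trans : ∀ {m} {G : Graph m} {x y z} → Reach G x y → Reach G y z → Reach G x z
reach-trans here       q = q
reach-trans (step e p) q = step e (reach-trans p q)

module RoseWindowGraph (n a r : ℕ) ⦃ _ : NonZero n ⦄ where

  open Modular n

  G : Graph (n ℕ.+ n)
  G = RoseWindow n a r

  v u : Fin n → Fin (n ℕ.+ n)
  v i = i ↑ˡ n
  u i = n ↑ʳ i

  vertex-elim : ∀ {ℓ} (P : Fin (n ℕ.+ n) → Set ℓ) →
    (∀ i → P (v i)) → (∀ i → P (u i)) → ∀ w → P w
  vertex-elim P Pv Pu w with splitAt n w in eq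
  ... | inj₁ i = subst P (splitAt⁻¹-↑ˡ eq) (Pv i)
  ... | inj₂ i = subst P (splitAt⁻¹-↑ʳ eq) (Pu i)

  roseAdj-v-v : ∀ i j → adj G (v i) (v j) ≡ eqShift j i 1 ∨ eqShift i j 1
  roseAdj-v-v i j rewrite splitAt-↑ˡ n i n | splitAt-↑ˡ n j n = refl

  roseAdj-v-u : ∀ i j → adj G (v i) (u j) ≡ eqShift i j 0 ∨ eqShift i j a
  roseAdj-v-u i j rewrite splitAt-↑ˡ n i n | splitAt-↑ʳ n n j = refl

  roseAdj-u-v : ∀ i j → adj G (u i) (v j) ≡ eqShift j i 0 ∨ eqShift j i a
  roseAdj-u-v i j rewrite splitAt-↑ʳ n n i | splitAt-↑ˡ n j n = refl

  roseAdj-u-u : ∀ i j → adj G (u i) (u j) ≡ eqShift j i r ∨ eqShift i j r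
  roseAdj-u-u i j rewrite splitAt-↑ʳ n n i | splitAt-↑ʳ n n j = refl

  eqShift-self : ∀ i k → eqShift (i ⊕ k) i k ≡ true
  eqShift-self i k = trans (eqShift-⊕ (i ⊕ k) i k) (dec-true (i ⊕ k Fin.≟ i ⊕ k) refl)

  eqShift-refl : ∀ i → eqShift i i 0 ≡ true
  eqShift-refl i = subst (λ j → eqShift j i 0 ≡ true) (⊕-identityʳ i) (eqShift-self i 0)

  edge-v-next : ∀ i → adj G (v i) (v (i ⊕ 1)) ≡ true
  edge-v-next i = trans (roseAdj-v-v i (i ⊕ 1)) (cong (_∨ eqShift i (i ⊕ 1) 1) (eqShift-self i 1))

  edge-v-u : ∀ i → adj G (v i) (u i) ≡ true
  edge-v-u i = trans (roseAdj-v-u i i) (cong (_∨ eqShift i i a) (eqShift-refl i))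

  edge-u-v : ∀ i → adj G (u i) (v i) ≡ true
  edge-u-v i = trans (roseAdj-u-v i i) (cong (_∨ eqShift i i a) (eqShift-refl i))

  reach-rim : ∀ k m → Reach G (v (m mod n)) (v ((k ℕ.+ m) mod n))
  reach-rim zero    m = here
  reach-rim (suc k) m = step
    (subst (λ j → adj G (v (m mod n)) (v j) ≡ true) (mod-⊕ m 1) (edge-v-next (m mod n)))
    (subst (λ t → Reach G (v ((1 ℕ.+ m) mod n)) (v (t mod n))) (ℕP.+-suc k m) (reach-rim k (suc m)))

  hub : Fin (n ℕ.+ n)
  hub = v (0 mod n)

  from-hub : ∀ w → Reach G hub w
  from-hub = vertex-elim (Reach G hub) to-v (λ i → reach-trans (to-v i) (step (edge-v-u i) here))
    where
    to-v : ∀ i → Reach G hub (v i)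
    to-v i = subst (Reach G hub ∘ v) (⊕-identityʳ i) (reach-rim (toℕ i) 0)

  to-hub : ∀ w → Reach G w hub
  to-hub = vertex-elim (λ w → Reach G w hub) from-v (λ i → step (edge-u-v i) (from-v i))
    where
    around : ∀ i → (n ∸ toℕ i ℕ.+ toℕ i) mod n ≡ 0 mod n
    around i = begin
      (n ∸ toℕ i ℕ.+ toℕ i) mod n ≡⟨ cong (_mod n) (ℕP.m∸n+n≡m (ℕP.<⇒≤ (toℕ<n i))) ⟩
      n mod n                     ≡⟨ cong (_mod n) (ℕP.+-identityʳ n) ⟨
      (n ℕ.+ 0) mod n             ≡⟨ [n+m]mod≡m-mod 0 ⟩
      0 mod n                     ∎
    from-v : ∀ i → Reach G (v i) hub
    from-v i = subst₂ (λ p q → Reach G (v p) (v q)) (toℕ-mod-id i) (around i)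
                      (reach-rim (n ∸ toℕ i) (toℕ i))

  connected : Connected G
  connected x y = reach-trans (to-hub x) (from-hub y)

  module Rows (0<a : 0 < a) (a<n : a < n) (0<r : 0 < r) (r+r<n : r ℕ.+ r < n) where

    private
      2<n : 2 < n
      2<n = ℕP.≤-<-trans (ℕP.+-mono-≤ 0<r 0<r) r+r<n
      1<n : 1 < n
      1<n = ℕP.<-trans (ℕP.n<1+n 1) 2<n
      r<n : r < n
      r<n = ℕP.m+n≤o⇒m≤o (suc r) r+r<n
      1≤n : 1 ≤ n
      1≤n = ℕP.<⇒≤ 1<n
      a≤n : a ≤ n
      a≤n = ℕP.<⇒≤ a<n
      r≤n : r ≤ n
      r≤n = ℕP.<⇒≤ r<n
      n∸k<n : ∀ {k} → 0 < k → k ≤ n → n ∸ k < n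
      n∸k<n = ℕP.∸-monoʳ-<

    adj-v-v : ∀ i j → adj G (v i) (v j) ≡ does (j Fin.≟ i ⊕ 1) ∨ does (j Fin.≟ i ⊕ (n ∸ 1))
    adj-v-v i j = trans (roseAdj-v-v i j) (cong₂ _∨_ (eqShift-⊕ j i 1) (eqShift-⊖ i j 1 1≤n))

    adj-v-u : ∀ i j → adj G (v i) (u j) ≡ does (j Fin.≟ i) ∨ does (j Fin.≟ i ⊕ (n ∸ a))
    adj-v-u i j = trans (roseAdj-v-u i j) (cong₂ _∨_
      (trans (eqShift-⊖ i j 0 z≤n) (cong (does ∘ (j Fin.≟_)) (⊕-n i))) (eqShift-⊖ i j a a≤n))

    adj-u-v : ∀ i j → adj G (u i) (v j) ≡ does (j Fin.≟ i) ∨ does (j Fin.≟ i ⊕ a)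
    adj-u-v i j = trans (roseAdj-u-v i j) (cong₂ _∨_
      (trans (eqShift-⊕ j i 0) (cong (does ∘ (j Fin.≟_)) (⊕-identityʳ i))) (eqShift-⊕ j i a))

    adj-u-u : ∀ i j → adj G (u i) (u j) ≡ does (j Fin.≟ i ⊕ r) ∨ does (j Fin.≟ i ⊕ (n ∸ r))
    adj-u-u i j = trans (roseAdj-u-u i j) (cong₂ _∨_ (eqShift-⊕ j i r) (eqShift-⊖ i j r r≤n))

    row-split : ∀ y w → row G y w ≡
      sum (λ j → adjMatrix G w (v j) * y (v j)) + sum (λ j → adjMatrix G w (u j) * y (u j))
    row-split y w = trans (sumFin≡sum terms) (sum-↑ n terms)
      where
      terms : Fin (n ℕ.+ n) → ℚ
      terms w′ = adjMatrix G w w′ * y w′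

    sum-neighbours : ∀ y {w} (f : Fin n → Fin (n ℕ.+ n)) {p q} →
      (∀ j → adj G w (f j) ≡ does (j Fin.≟ p) ∨ does (j Fin.≟ q)) → p ≢ q →
      sum (λ j → adjMatrix G w (f j) * y (f j)) ≡ y (f p) + y (f q)
    sum-neighbours y {w} f = sum-two-points (adj G w ∘ f) (y ∘ f)

    row-v : ∀ y i →
      row G y (v i) ≡ y (v (i ⊕ 1)) + y (v (i ⊕ (n ∸ 1))) + (y (u i) + y (u (i ⊕ (n ∸ a))))
    row-v y i = trans (row-split y (v i)) (cong₂ _+_
      (sum-neighbours y v (adj-v-v i) (⊕-distinct i 1<n (n∸k<n (s≤s z≤n) 1≤n) 1≢n∸1))
      (sum-neighbours y u (adj-v-u i) (≢-⊕ i (n∸k<n 0<a a≤n) (≢-∸ a≤n (ℕP.<⇒≢ a<n)))))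
      where
      1≢n∸1 : 1 ≢ n ∸ 1
      1≢n∸1 = ≢-∸ 1≤n (ℕP.<⇒≢ 2<n)

    row-u : ∀ y i →
      row G y (u i) ≡ y (v i) + y (v (i ⊕ a)) + (y (u (i ⊕ r)) + y (u (i ⊕ (n ∸ r))))
    row-u y i = trans (row-split y (u i)) (cong₂ _+_
      (sum-neighbours y v (adj-u-v i) (≢-⊕ i a<n (ℕP.<⇒≢ 0<a)))
      (sum-neighbours y u (adj-u-u i) (⊕-distinct i r<n (n∸k<n 0<r r≤n) r≢n∸r)))
      where
      r≢n∸r : r ≢ n ∸ r
      r≢n∸r = ≢-∸ r≤n (ℕP.<⇒≢ r+r<n)

-- Periodic sequences

Periodic : ∀ {a} {A : Set a} → ℕ → (ℕ → A) → Set a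
Periodic p f = ∀ m → f (p ℕ.+ m) ≡ f m

module _ {a} {A : Set a} {f : ℕ → A} where

  periodic-* : ∀ {p} → Periodic p f → ∀ k m → f (k ℕ.* p ℕ.+ m) ≡ f m
  periodic-*     per zero    m = refl
  periodic-* {p} per (suc k) m =
    trans (cong f (ℕP.+-assoc p (k ℕ.* p) m)) (trans (per _) (periodic-* per k m))

  periodic-∣ : ∀ {p q} → p ∣ q → Periodic p f → Periodic q f
  periodic-∣ (divides k refl) per = periodic-* per k

  periodic-Bézout : ∀ {p q d} → Periodic p f → Periodic q f → Bézout.Identity d p q → Periodic d f
  periodic-Bézout {p} {q} {d} per-p per-q (Bézout.+- x y eq) m = begin
    f (d ℕ.+ m)               ≡⟨ periodic-* per-q y (d ℕ.+ m) ⟨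
    f (y ℕ.* q ℕ.+ (d ℕ.+ m)) ≡⟨ cong f (ℕP.+-assoc (y ℕ.* q) d m) ⟨
    f (y ℕ.* q ℕ.+ d ℕ.+ m)   ≡⟨ cong (λ t → f (t ℕ.+ m)) (trans (ℕP.+-comm (y ℕ.* q) d) eq) ⟩
    f (x ℕ.* p ℕ.+ m)         ≡⟨ periodic-* per-p x m ⟩
    f m                       ∎
  periodic-Bézout per-p per-q (Bézout.-+ x y eq) = periodic-Bézout per-q per-p (Bézout.+- y x eq)

  periodic-1⇒constant : Periodic 1 f → ∀ m → f m ≡ f 0
  periodic-1⇒constant per zero    = refl
  periodic-1⇒constant per (suc m) = trans (per m) (periodic-1⇒constant per m)

  coprime-periods⇒constant : ∀ {p q} → Coprime p q →
    Periodic p f → Periodic q f → ∀ m → f m ≡ f 0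
  coprime-periods⇒constant p⊥q per-p per-q =
    periodic-1⇒constant (periodic-Bézout per-p per-q (coprime-Bézout p⊥q))

  periodic-% : ∀ {n} ⦃ _ : NonZero n ⦄ → Periodic n f → ∀ m → f (m % n) ≡ f m
  periodic-% {n} per m = begin
    f (m % n)                 ≡⟨ periodic-* per (m / n) (m % n) ⟨
    f (m / n ℕ.* n ℕ.+ m % n) ≡⟨ cong f (ℕP.+-comm (m / n ℕ.* n) (m % n)) ⟩
    f (m % n ℕ.+ m / n ℕ.* n) ≡⟨ cong f (m≡m%n+[m/n]*n m n) ⟨
    f m                       ∎

irreducible∧∤⇒coprime : ∀ {p n} → Irreducible p → ¬ p ∣ n → Coprime p n
irreducible∧∤⇒coprime irr p∤n (d∣p , d∣n) with irr d∣p
... | inj₁ d≡1  = d≡1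
... | inj₂ refl = ⊥-elim (p∤n d∣n)

irreducible[3] : Irreducible 3
irreducible[3] = toWitness {a? = irreducible? 3} _

repeat₃ : ∀ {a} {A : Set a} → A → A → A → ℕ → A
repeat₃ x y z zero                = x
repeat₃ x y z (suc zero)          = y
repeat₃ x y z (suc (suc zero))    = z
repeat₃ x y z (suc (suc (suc m))) = repeat₃ x y z m

ℕ-ind₃ : ∀ {p} (P : ℕ → Set p) → P 0 → P 1 → P 2 → (∀ m → P m → P (3 ℕ.+ m)) → ∀ m → P m
ℕ-ind₃ P P0 P1 P2 P+3 zero                = P0
ℕ-ind₃ P P0 P1 P2 P+3 (suc zero)          = P1
ℕ-ind₃ P P0 P1 P2 P+3 (suc (suc zero))    = P2
ℕ-ind₃ P P0 P1 P2 P+3 (suc (suc (suc m))) = P+3 m (ℕ-ind₃ P P0 P1 P2 P+3 m)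

p*q≡0⇒p≡0 : ∀ {p q} → q ≢ 0ℚ → p * q ≡ 0ℚ → p ≡ 0ℚ
p*q≡0⇒p≡0 {p} {q} q≢0 pq≡0 = begin
  p              ≡⟨ ℚP.*-identityʳ p ⟨
  p * 1ℚ         ≡⟨ cong (p *_) (ℚP.*-inverseʳ q) ⟨
  p * (q * 1/ q) ≡⟨ ℚP.*-assoc p q (1/ q) ⟨
  p * q * 1/ q   ≡⟨ cong (_* 1/ q) pq≡0 ⟩
  0ℚ * 1/ q      ≡⟨ ℚP.*-zeroˡ (1/ q) ⟩
  0ℚ             ∎
  where instance _ = ℚ.≢-nonZero q≢0

0<k·1 : ∀ k ⦃ _ : NonZero k ⦄ → 0ℚ ℚ.< k · 1ℚ
0<k·1 (suc zero)    = ℚP.positive⁻¹ 1ℚ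
0<k·1 (suc (suc k)) = ℚP.+-mono-< (ℚP.positive⁻¹ 1ℚ) (0<k·1 (suc k))

k·p≡0⇒p≡0 : ∀ k ⦃ _ : NonZero k ⦄ {p} → k · p ≡ 0ℚ → p ≡ 0ℚ
k·p≡0⇒p≡0 k {p} k·p≡0 = p*q≡0⇒p≡0 (≢-sym (ℚP.<⇒≢ (0<k·1 k))) (begin
  p * (k · 1ℚ) ≡⟨ ℚP.*-comm p (k · 1ℚ) ⟩
  (k · 1ℚ) * p ≡⟨ ×-assoc-* k 1ℚ p ⟩
  k · (1ℚ * p) ≡⟨ cong (k ·_) (ℚP.*-identityˡ p) ⟩
  k · p        ≡⟨ k·p≡0 ⟩
  0ℚ           ∎)

periodic-progression⇒difference≡0 : ∀ {p q c} {f : ℕ → ℚ} ⦃ _ : NonZero q ⦄ →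
  (∀ m → f (p ℕ.+ m) ≡ c + f m) → Periodic q f → c ≡ 0ℚ
periodic-progression⇒difference≡0 {p} {q} {c} {f} progression per =
  k·p≡0⇒p≡0 q (identityˡ-unique (q · c) (f 0) (begin
    q · c + f 0       ≡⟨ steps q 0 ⟨
    f (q ℕ.* p ℕ.+ 0) ≡⟨ cong (λ t → f (t ℕ.+ 0)) (ℕP.*-comm q p) ⟩
    f (p ℕ.* q ℕ.+ 0) ≡⟨ periodic-* per p 0 ⟩
    f 0               ∎))
  where
  steps : ∀ k m → f (k ℕ.* p ℕ.+ m) ≡ k · c + f m
  steps zero    m = sym (ℚP.+-identityˡ (f m))
  steps (suc k) m = begin
    f (p ℕ.+ k ℕ.* p ℕ.+ m)   ≡⟨ cong f (ℕP.+-assoc p (k ℕ.* p) m) ⟩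
    f (p ℕ.+ (k ℕ.* p ℕ.+ m)) ≡⟨ progression _ ⟩
    c + f (k ℕ.* p ℕ.+ m)     ≡⟨ cong (c +_) (steps k m) ⟩
    c + (k · c + f m)         ≡⟨ ℚP.+-assoc c (k · c) (f m) ⟨
    c + k · c + f m           ∎

independent-kernel⇒¬nullityOne : ∀ {m} {G : Graph m} {y z w w′} → InKernel G y → InKernel G z →
  y w ≢ 0ℚ → z w ≡ 0ℚ → z w′ ≢ 0ℚ → ¬ NullityOne G
independent-kernel⇒¬nullityOne {y = y} {z} {w} {w′} y∈ker z∈ker yw≢0 zw≡0 zw′≢0
  (x , _ , _ , spans) = zw′≢0 (begin
    z w′      ≡⟨ z≡dx w′ ⟩
    d * x w′  ≡⟨ cong (_* x w′) d≡0 ⟩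
    0ℚ * x w′ ≡⟨ ℚP.*-zeroˡ (x w′) ⟩
    0ℚ        ∎)
  where
  c d : ℚ
  c = proj₁ (spans y y∈ker)
  d = proj₁ (spans z z∈ker)
  y≡cx : ∀ w → y w ≡ c * x w
  y≡cx = proj₂ (spans y y∈ker)
  z≡dx : ∀ w → z w ≡ d * x w
  z≡dx = proj₂ (spans z z∈ker)
  xw≢0 : x w ≢ 0ℚ
  xw≢0 xw≡0 = yw≢0 (trans (y≡cx w) (trans (cong (c *_) xw≡0) (ℚP.*-zeroʳ c)))
  d≡0 : d ≡ 0ℚ
  d≡0 = p*q≡0⇒p≡0 xw≢0 (trans (sym (z≡dx w)) zw≡0)

-- The kernel recurrence of R_n(1,2)

-- The rows of v_{m+1} and of u_{m+2}, for A m = x(v_m) and B m = x(u_m).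
record KernelRecurrence (A B : ℕ → ℚ) : Set where
  field
    v-row : ∀ m → A (2 ℕ.+ m) + A m + (B (1 ℕ.+ m) + B m) ≡ 0ℚ
    u-row : ∀ m → A (2 ℕ.+ m) + A (3 ℕ.+ m) + (B (4 ℕ.+ m) + B m) ≡ 0ℚ

open KernelRecurrence

kernelRecurrence-cong : ∀ {A A′ B B′} → A ≗ A′ → B ≗ B′ →
  KernelRecurrence A B → KernelRecurrence A′ B′
kernelRecurrence-cong A≗A′ B≗B′ rec = record
  { v-row = λ m → trans (sym (terms≡ (A≗A′ _) (A≗A′ m) (B≗B′ _) (B≗B′ m))) (v-row rec m)
  ; u-row = λ m → trans (sym (terms≡ (A≗A′ _) (A≗A′ _) (B≗B′ _) (B≗B′ m))) (u-row rec m)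
  }
  where
  terms≡ : ∀ {a b c d a′ b′ c′ d′} → a ≡ a′ → b ≡ b′ → c ≡ c′ → d ≡ d′ →
    a + b + (c + d) ≡ a′ + b′ + (c′ + d′)
  terms≡ refl refl refl refl = refl

module _ {A B : ℕ → ℚ} (rec : KernelRecurrence A B) where

  third-difference-periodic : Periodic 3 (λ m → A (3 ℕ.+ m) - A m)
  third-difference-periodic m = x∙y⁻¹≈ε⇒x≈y _ _ (begin
    A (6 ℕ.+ m) - A (3 ℕ.+ m) - (A (3 ℕ.+ m) - A m)
      ≡⟨ combination (A m) (A (2 ℕ.+ m)) (A (3 ℕ.+ m)) (A (4 ℕ.+ m)) (A (6 ℕ.+ m))
                     (B m) (B (1 ℕ.+ m)) (B (4 ℕ.+ m)) (B (5 ℕ.+ m)) ⟩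
    v-expr (4 ℕ.+ m) + v-expr m - (u-expr m + u-expr (1 ℕ.+ m))
      ≡⟨ cong₂ _-_ (cong₂ _+_ (v-row rec (4 ℕ.+ m)) (v-row rec m))
                   (cong₂ _+_ (u-row rec m) (u-row rec (1 ℕ.+ m))) ⟩
    0ℚ ∎)
    where
    v-expr u-expr : ℕ → ℚ
    v-expr m = A (2 ℕ.+ m) + A m + (B (1 ℕ.+ m) + B m)
    u-expr m = A (2 ℕ.+ m) + A (3 ℕ.+ m) + (B (4 ℕ.+ m) + B m)
    combination : ∀ a₀ a₂ a₃ a₄ a₆ b₀ b₁ b₄ b₅ →
      a₆ - a₃ - (a₃ - a₀) ≡
      a₆ + a₄ + (b₅ + b₄) + (a₂ + a₀ + (b₁ + b₀)) - (a₂ + a₃ + (b₄ + b₀) + (a₃ + a₄ + (b₅ + b₁)))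
    combination = solve 9 (λ a₀ a₂ a₃ a₄ a₆ b₀ b₁ b₄ b₅ →
      a₆ :- a₃ :- (a₃ :- a₀) :=
      a₆ :+ a₄ :+ (b₅ :+ b₄) :+ (a₂ :+ a₀ :+ (b₁ :+ b₀))
        :- (a₂ :+ a₃ :+ (b₄ :+ b₀) :+ (a₃ :+ a₄ :+ (b₅ :+ b₁)))) refl

  kernelRecurrence-A-constant : ∀ {n} ⦃ _ : NonZero n ⦄ →
    Coprime 3 n → Periodic n A → ∀ m → A m ≡ A 0
  kernelRecurrence-A-constant {n} 3⊥n per-A = coprime-periods⇒constant 3⊥n 3-periodic per-A
    where
    d : ℕ → ℚ
    d m = A (3 ℕ.+ m) - A m
    3+[n+m]≡n+[3+m] : ∀ m → 3 ℕ.+ (n ℕ.+ m) ≡ n ℕ.+ (3 ℕ.+ m)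
    3+[n+m]≡n+[3+m] m =
      trans (sym (ℕP.+-assoc 3 n m)) (trans (cong (ℕ._+ m) (ℕP.+-comm 3 n)) (ℕP.+-assoc n 3 m))
    per-d : Periodic n d
    per-d m = cong₂ _-_ (trans (cong A (3+[n+m]≡n+[3+m] m)) (per-A (3 ℕ.+ m))) (per-A m)
    progression : ∀ m → A (3 ℕ.+ m) ≡ d 0 + A m
    progression m = begin
      A (3 ℕ.+ m)     ≡⟨ solve 2 (λ x y → x := x :- y :+ y) refl (A (3 ℕ.+ m)) (A m) ⟩
      d m + A m       ≡⟨ cong (_+ A m) (coprime-periods⇒constant 3⊥n third-difference-periodic per-d m) ⟩
      d 0 + A m       ∎
    3-periodic : Periodic 3 A
    3-periodic m = begin
      A (3 ℕ.+ m) ≡⟨ progression m ⟩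
      d 0 + A m   ≡⟨ cong (_+ A m) (periodic-progression⇒difference≡0 {c = d 0} progression per-A) ⟩
      0ℚ + A m    ≡⟨ ℚP.+-identityˡ (A m) ⟩
      A m         ∎

  kernelRecurrence-B-constant : ∀ {c} → (∀ m → A m ≡ c) → ∀ m → B m ≡ - c
  kernelRecurrence-B-constant {c} A≡c m = inverseʳ-unique c (B m) (k·p≡0⇒p≡0 2 (begin
    c + B m + (c + B m + 0ℚ)
      ≡⟨ solve 2 (λ c b → c :+ b :+ (c :+ b :+ con 0ℚ) := c :+ c :+ (b :+ b)) refl c (B m) ⟩
    c + c + (B m + B m)
      ≡⟨ cong₂ _+_ (cong₂ _+_ (A≡c (2 ℕ.+ m)) (A≡c (3 ℕ.+ m)))
                   (cong (_+ B m) (periodic-* 2-periodic 2 m)) ⟨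
    A (2 ℕ.+ m) + A (3 ℕ.+ m) + (B (4 ℕ.+ m) + B m)
      ≡⟨ u-row rec m ⟩
    0ℚ ∎))
    where
    v-row-c : ∀ m → c + c + (B (1 ℕ.+ m) + B m) ≡ 0ℚ
    v-row-c m = trans (cong₂ (λ x y → x + y + (B (1 ℕ.+ m) + B m)) (sym (A≡c (2 ℕ.+ m))) (sym (A≡c m)))
                      (v-row rec m)
    2-periodic : Periodic 2 B
    2-periodic m = x∙y⁻¹≈ε⇒x≈y _ _ (begin
      B (2 ℕ.+ m) - B m
        ≡⟨ solve 4 (λ c b₂ b₁ b₀ → b₂ :- b₀ := c :+ c :+ (b₂ :+ b₁) :- (c :+ c :+ (b₁ :+ b₀))) refl
                   c (B (2 ℕ.+ m)) (B (1 ℕ.+ m)) (B m) ⟩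
      c + c + (B (2 ℕ.+ m) + B (1 ℕ.+ m)) - (c + c + (B (1 ℕ.+ m) + B m))
        ≡⟨ cong₂ _-_ (v-row-c (1 ℕ.+ m)) (v-row-c m) ⟩
      0ℚ ∎)

-- The kernel of R_n(1,2)

module RoseWindow₁₂ (n : ℕ) ⦃ _ : NonZero n ⦄ (5≤n : 5 ≤ n) where

  open Modular n
  open RoseWindowGraph n 1 2 public
  open Rows (s≤s z≤n) (ℕP.<-≤-trans (s≤s (s≤s z≤n)) 5≤n) (s≤s z≤n) 5≤n

  private
    1≤n : 1 ≤ n
    1≤n = ℕP.≤-trans (s≤s z≤n) 5≤n
    2≤n : 2 ≤ n
    2≤n = ℕP.≤-trans (s≤s (s≤s z≤n)) 5≤n

  seqV seqU : (Fin (n ℕ.+ n) → ℚ) → ℕ → ℚ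
  seqV y m = y (v (m mod n))
  seqU y m = y (u (m mod n))

  seqV-periodic : ∀ y → Periodic n (seqV y)
  seqV-periodic y m = cong (y ∘ v) ([n+m]mod≡m-mod m)

  row-v-seq : ∀ y m → row G y (v ((1 ℕ.+ m) mod n)) ≡
    seqV y (2 ℕ.+ m) + seqV y m + (seqU y (1 ℕ.+ m) + seqU y m)
  row-v-seq y m = trans (row-v y i)
    (cong₂ (λ p q → y (v p) + y (v q) + (y (u i) + y (u q))) (mod-⊕ (1 ℕ.+ m) 1) (⊕-rotate m 1≤n))
    where
    i = (1 ℕ.+ m) mod n

  row-u-seq : ∀ y m → row G y (u ((2 ℕ.+ m) mod n)) ≡
    seqV y (2 ℕ.+ m) + seqV y (3 ℕ.+ m) + (seqU y (4 ℕ.+ m) + seqU y m)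
  row-u-seq y m = begin
    row G y (u i)
      ≡⟨ row-u y i ⟩
    y (v i) + y (v (i ⊕ 1)) + (y (u (i ⊕ 2)) + y (u (i ⊕ (n ∸ 2))))
      ≡⟨ cong₂ (λ p q → y (v i) + y (v p) + (y (u q) + y (u (i ⊕ (n ∸ 2)))))
               (mod-⊕ (2 ℕ.+ m) 1) (mod-⊕ (2 ℕ.+ m) 2) ⟩
    y (v i) + y (v ((3 ℕ.+ m) mod n)) + (y (u ((4 ℕ.+ m) mod n)) + y (u (i ⊕ (n ∸ 2))))
      ≡⟨ cong (λ p → y (v i) + y (v ((3 ℕ.+ m) mod n)) + (y (u ((4 ℕ.+ m) mod n)) + y (u p)))
              (⊕-rotate m 2≤n) ⟩
    seqV y (2 ℕ.+ m) + seqV y (3 ℕ.+ m) + (seqU y (4 ℕ.+ m) + seqU y m) ∎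
    where
    i = (2 ℕ.+ m) mod n

  inKernel⇔recurrence : ∀ y → InKernel G y ⇔ KernelRecurrence (seqV y) (seqU y)
  inKernel⇔recurrence y = mk⇔ to from
    where
    to : InKernel G y → KernelRecurrence (seqV y) (seqU y)
    to y∈ker = record
      { v-row = λ m → trans (sym (row-v-seq y m)) (y∈ker _)
      ; u-row = λ m → trans (sym (row-u-seq y m)) (y∈ker _)
      }
    reindex : ∀ {k} → k ≤ n → ∀ i → (k ℕ.+ (toℕ i ℕ.+ (n ∸ k))) mod n ≡ i
    reindex k≤n i = begin
      _                     ≡⟨ cong (_mod n) (k+[m+[n∸k]]≡n+m (toℕ i) k≤n) ⟩
      (n ℕ.+ toℕ i) mod n   ≡⟨ [n+m]mod≡m-mod (toℕ i) ⟩
      toℕ i mod n           ≡⟨ toℕ-mod-id i ⟩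
      i                     ∎
    from : KernelRecurrence (seqV y) (seqU y) → InKernel G y
    from rec = vertex-elim (λ w → row G y w ≡ 0ℚ)
      (λ i → subst (λ j → row G y (v j) ≡ 0ℚ) (reindex 1≤n i) (trans (row-v-seq y _) (v-row rec _)))
      (λ i → subst (λ j → row G y (u j) ≡ 0ℚ) (reindex 2≤n i) (trans (row-u-seq y _) (u-row rec _)))

  fromSeqs : (ℕ → ℚ) → (ℕ → ℚ) → Fin (n ℕ.+ n) → ℚ
  fromSeqs A B w = [ A ∘ toℕ , B ∘ toℕ ]′ (splitAt n w)

  fromSeqs-v : ∀ A B i → fromSeqs A B (v i) ≡ A (toℕ i)
  fromSeqs-v A B i rewrite splitAt-↑ˡ n i n = refl

  fromSeqs-u : ∀ A B i → fromSeqs A B (u i) ≡ B (toℕ i)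
  fromSeqs-u A B i rewrite splitAt-↑ʳ n n i = refl

  seqV-fromSeqs : ∀ {A} B → Periodic n A → seqV (fromSeqs A B) ≗ A
  seqV-fromSeqs {A} B per m =
    trans (fromSeqs-v A B (m mod n)) (trans (cong A (toℕ-mod m)) (periodic-% per m))

  seqU-fromSeqs : ∀ A {B} → Periodic n B → seqU (fromSeqs A B) ≗ B
  seqU-fromSeqs A {B} per m =
    trans (fromSeqs-u A B (m mod n)) (trans (cong B (toℕ-mod m)) (periodic-% per m))

  fromSeqs-inKernel : ∀ {A B} → Periodic n A → Periodic n B →
    KernelRecurrence A B → InKernel G (fromSeqs A B)
  fromSeqs-inKernel {A} {B} per-A per-B rec = Equivalence.from (inKernel⇔recurrence (fromSeqs A B))
    (kernelRecurrence-cong (sym ∘ seqV-fromSeqs B per-A) (sym ∘ seqU-fromSeqs A per-B) rec)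

  sign-vector : Fin (n ℕ.+ n) → ℚ
  sign-vector = fromSeqs (λ _ → - 1ℚ) (λ _ → 1ℚ)

  sign-vector-inKernel : InKernel G sign-vector
  sign-vector-inKernel =
    fromSeqs-inKernel (λ _ → refl) (λ _ → refl) (record { v-row = λ _ → refl ; u-row = λ _ → refl })

  sign-vector-full : FullVec sign-vector
  sign-vector-full = vertex-elim (λ w → sign-vector w ≢ 0ℚ)
    (λ i → -1≢0 ∘ trans (sym (fromSeqs-v _ _ i)))
    (λ i → ℚP.1≢0 ∘ trans (sym (fromSeqs-u _ _ i)))
    where
    -1≢0 : - 1ℚ ≢ 0ℚ
    -1≢0 ()

  core : IsCore G
  core = (sign-vector , sign-vector-inKernel , hub , sign-vector-full hub)
       , (sign-vector , sign-vector-inKernel , sign-vector-full)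

  nullityOne : Coprime 3 n → NullityOne G
  nullityOne 3⊥n = sign-vector , sign-vector-inKernel , (hub , sign-vector-full hub) , spans
    where
    spans : ∀ y → InKernel G y → Σ ℚ λ c → ∀ w → y w ≡ c * sign-vector w
    spans y y∈ker = - c , vertex-elim (λ w → y w ≡ - c * sign-vector w) on-v on-u
      where
      rec = Equivalence.to (inKernel⇔recurrence y) y∈ker
      c = seqV y 0
      A-constant : ∀ m → seqV y m ≡ c
      A-constant = kernelRecurrence-A-constant rec 3⊥n (seqV-periodic y)
      on-v : ∀ i → y (v i) ≡ - c * sign-vector (v i)
      on-v i = begin
        y (v i)                 ≡⟨ cong (y ∘ v) (toℕ-mod-id i) ⟨
        seqV y (toℕ i)          ≡⟨ A-constant (toℕ i) ⟩
        c                       ≡⟨ solve 1 (λ c → c := (:- c) :* (:- con 1ℚ)) refl c ⟩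
        - c * - 1ℚ              ≡⟨ cong (- c *_) (fromSeqs-v _ _ i) ⟨
        - c * sign-vector (v i) ∎
      on-u : ∀ i → y (u i) ≡ - c * sign-vector (u i)
      on-u i = begin
        y (u i)                 ≡⟨ cong (y ∘ u) (toℕ-mod-id i) ⟨
        seqU y (toℕ i)          ≡⟨ kernelRecurrence-B-constant rec A-constant (toℕ i) ⟩
        - c                     ≡⟨ ℚP.*-identityʳ (- c) ⟨
        - c * 1ℚ                ≡⟨ cong (- c *_) (fromSeqs-u _ _ i) ⟨
        - c * sign-vector (u i) ∎

  3∣n⇒¬nullityOne : 3 ∣ n → ¬ NullityOne G
  3∣n⇒¬nullityOne 3∣n = independent-kernel⇒¬nullityOne
    {G = G} {fromSeqs A₁ B₁} {fromSeqs A₂ B₂} {u (0 mod n)} {u (1 mod n)}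
    (fromSeqs-inKernel (per 0ℚ 0ℚ (- 1ℚ)) (per 1ℚ 0ℚ 0ℚ) rec₁)
    (fromSeqs-inKernel (per (- 1ℚ) 0ℚ 0ℚ) (per 0ℚ 1ℚ 0ℚ) rec₂)
    (ℚP.1≢0 ∘ trans (sym (seqU-fromSeqs A₁ (per 1ℚ 0ℚ 0ℚ) 0)))
    (seqU-fromSeqs A₂ (per 0ℚ 1ℚ 0ℚ) 0)
    (ℚP.1≢0 ∘ trans (sym (seqU-fromSeqs A₂ (per 0ℚ 1ℚ 0ℚ) 1)))
    where
    A₁ B₁ A₂ B₂ : ℕ → ℚ
    A₁ = repeat₃ 0ℚ 0ℚ (- 1ℚ)
    B₁ = repeat₃ 1ℚ 0ℚ 0ℚ
    A₂ = repeat₃ (- 1ℚ) 0ℚ 0ℚ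
    B₂ = repeat₃ 0ℚ 1ℚ 0ℚ
    per : ∀ x y z → Periodic n (repeat₃ x y z)
    per x y z = periodic-∣ 3∣n (λ _ → refl)
    rec₁ : KernelRecurrence A₁ B₁
    -- Both rows of a 3-periodic pair are 3-periodic in m, so it suffices to check m = 0, 1, 2.
    rec₁ = record { v-row = ℕ-ind₃ _ refl refl refl (λ _ p → p)
                  ; u-row = ℕ-ind₃ _ refl refl refl (λ _ p → p) }
    rec₂ : KernelRecurrence A₂ B₂
    rec₂ = record { v-row = ℕ-ind₃ _ refl refl refl (λ _ p → p)
                  ; u-row = ℕ-ind₃ _ refl refl refl (λ _ p → p) }

proposition15 : (n : ℕ) → ⦃ _ : NonZero n ⦄ → 5 ≤ n →
    IsCore (RoseWindow n 1 2) × (IsNut (RoseWindow n 1 2) ⇔ (¬ (n % 3 ≡ 0)))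
proposition15 n 5≤n = core , mk⇔ nut⇒n%3≢0 n%3≢0⇒nut
  where
  open RoseWindow₁₂ n 5≤n
  nut⇒n%3≢0 : IsNut G → ¬ (n % 3 ≡ 0)
  nut⇒n%3≢0 (_ , _ , nullity≡1) n%3≡0 = 3∣n⇒¬nullityOne (m%n≡0⇒n∣m n 3 n%3≡0) nullity≡1
  n%3≢0⇒nut : ¬ (n % 3 ≡ 0) → IsNut G
  n%3≢0⇒nut n%3≢0 = connected , core , nullityOne 3⊥n
    where
    3⊥n : Coprime 3 n
    3⊥n = irreducible∧∤⇒coprime irreducible[3] (n%3≢0 ∘ n∣m⇒m%n≡0 n 3)
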